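{- Let $d$ be a positive integer and let $M_1,\dots,M_t:[k]^d\to\mathbb{F}_2$ be $d$-dimensional tensors of rank at most $1$, each identified with its $d$-linear form $M_i(x_1,\dots,x_d)=\sum_{(i_1,\dots,i_d)}M_i(i_1,\dots,i_d)x_{1,i_1}\cdots x_{d,i_d}$. Then $$\Pr_{x_1,\dots,x_d\in\mathbb{F}_2^k}\left[\forall i\in[t],\ M_i(x_1,\dots,x_d)=0\right]\ge\left(1-\frac{1}{2^d}\right)^t.$$
   Context: A tensor $T:[k]^d\to\mathbb{F}_2$ has rank at most one if it is zero or $T(i_1,\dots,i_d)=\prod_{j=1}^d u_j(i_j)$ for some $u_1,\dots,u_d\in\mathbb{F}_2^k$. The probability is over independent uniform $x_1,\dots,x_d$. -}

module Defs where

open import Data.Bool using (Bool; true; false; _∧_; _xor_; if_then_else_)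
open import Data.Nat using (ℕ; zero; suc; _+_)
open import Data.Fin using (Fin)
open import Data.List using (List; []; _∷_; map; concatMap; foldr; allFin)
open import Data.Nat.ListAction using (sum)
open import Data.Product using (Σ; _×_; _,_)
open import Data.Sum using (_⊎_)
open import Relation.Binary.PropositionalEquality using (_≡_)
import Data.Vec.Functional as VF

-- 𝔽₂ is modelled by Bool: addition = xor, multiplication = ∧.
F2 : Set
F2 = Bool

F2^ : ℕ → Set
F2^ k = Fin k → F2

Tensor : ℕ → ℕ → Set
Tensor k d = (Fin d → Fin k) → F2

prodF2 : ∀ {n} → (Fin n → F2) → F2
prodF2 = VF.foldr _∧_ true

sumF2 : List F2 → F2
sumF2 = foldr _xor_ false

allFuns : ∀ {A : Set} → List A → (n : ℕ) → List (Fin n → A)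
allFuns xs zero = (λ ()) ∷ []
allFuns xs (suc n) = concatMap (λ a → map (λ f → a VF.∷ f) (allFuns xs n)) xs

allF2 : List F2
allF2 = false ∷ true ∷ []

allVecs : (k : ℕ) → List (F2^ k)
allVecs k = allFuns allF2 k

allIdx : (k d : ℕ) → List (Fin d → Fin k)
allIdx k d = allFuns (allFin k) d

RankAtMostOne : ∀ {k d} → Tensor k d → Set
RankAtMostOne {k} {d} T =
  (∀ idx → T idx ≡ false) ⊎
  Σ (Fin d → F2^ k) (λ u → ∀ idx → T idx ≡ prodF2 (λ j → u j (idx j)))

multilinear : ∀ {k d} → Tensor k d → (Fin d → F2^ k) → F2
multilinear {k} {d} T x =
  sumF2 (map (λ idx → T idx ∧ prodF2 (λ j → x j (idx j))) (allIdx k d))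

allVanish : ∀ {k d t} → (Fin t → Tensor k d) → (Fin d → F2^ k) → Bool
allVanish M x = prodF2 (λ i → if multilinear (M i) x then false else true)

countVanish : ∀ {k d t} → (Fin t → Tensor k d) → ℕ
countVanish {k} {d} M =
  sum (map (λ x → if allVanish M x then 1 else 0) (allFuns (allVecs k) d))

-- A rank-one form ∏ⱼ ⟨uⱼ, xⱼ⟩ vanishes as soon as one factor does. Induct on d, writing
-- 2^(d-1) = b + 1. Fix the first argument x₁ = x₀: a form with ⟨u₁, x₀⟩ = 0 vanishes
-- identically, and the r(x₀) others restrict to rank-one forms in d - 1 arguments, so by
-- induction at least 2^(k(d-1)) (b / (b + 1))^r(x₀) of the points (x₀, x₂, …, x_d) are
-- common zeros. Summing over x₀, it remains to show ∑ₓ₀ ∏ᵢ (b + [⟨uᵢ₁, x₀⟩ = 0]) ≥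
-- 2^(k-t) (2b + 1)^t. Expanding the product over the subsets S of the forms, this follows
-- from the annihilator of S having at least 2^(k-|S|) elements: each new condition
-- ⟨v, x⟩ = 0 at most halves it, because translating by a point a of the annihilator with
-- ⟨v, a⟩ = 1 swaps the two halves.

module Submission where

open import Defs
open import Algebra.Bundles using (CommutativeSemiring)
open import Data.Fin using (Fin; zero; suc)
open import Data.List using (List; []; _∷_; _++_; map; concatMap; foldr)
open import Data.List.Properties using (map-∘)
open import Data.Nat using (ℕ; zero; suc)
open import Function using (_∘_)
import Data.Vec.Functional as VF
import Relation.Binary.PropositionalEquality as ≡

-- Instantiated at 𝔽₂ = (Bool, xor, ∧) and at ℕ, ∑ xs f is definitionally sumF2 (map f xs),
-- resp. sum (map f xs), and ∏ is prodF2.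
module ListSum {c ℓ} (R : CommutativeSemiring c ℓ) where

  open CommutativeSemiring R hiding (zero)
  open import Algebra.Properties.CommutativeSemigroup +-commutativeSemigroup
    using (interchange)
  open import Algebra.Properties.CommutativeMonoid.Sum *-commutativeMonoid public
    using () renaming (sum to ∏; ∑-distrib-+ to ∏-distrib-*)
  open import Relation.Binary.Reasoning.Setoid setoid

  private variable
    A B : Set

  ∑ : List A → (A → Carrier) → Carrier
  ∑ xs f = foldr _+_ 0# (map f xs)

  ∑-cong : ∀ (xs : List A) {f g : A → Carrier} →
    (∀ x → f x ≈ g x) → ∑ xs f ≈ ∑ xs g
  ∑-cong []       f≈g = refl
  ∑-cong (x ∷ xs) f≈g = +-cong (f≈g x) (∑-cong xs f≈g)

  ∑-++ : ∀ (xs ys : List A) f → ∑ (xs ++ ys) f ≈ ∑ xs f + ∑ ys f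
  ∑-++ []       ys f = sym (+-identityˡ _)
  ∑-++ (x ∷ xs) ys f = trans (+-congˡ (∑-++ xs ys f)) (sym (+-assoc _ _ _))

  ∑-map : ∀ (g : A → B) xs f → ∑ (map g xs) f ≡.≡ ∑ xs (f ∘ g)
  ∑-map g xs f = ≡.cong (foldr _+_ 0#) (≡.sym (map-∘ xs))

  ∑-concatMap : ∀ (g : A → List B) xs f →
    ∑ (concatMap g xs) f ≈ ∑ xs (λ a → ∑ (g a) f)
  ∑-concatMap g []       f = refl
  ∑-concatMap g (x ∷ xs) f = trans (∑-++ (g x) _ f) (+-congˡ (∑-concatMap g xs f))

  ∑-allFuns-suc : ∀ (xs : List A) (n : ℕ) (h : (Fin (suc n) → A) → Carrier) →
    ∑ (allFuns xs (suc n)) h ≈ ∑ xs (λ a → ∑ (allFuns xs n) (λ f → h (a VF.∷ f)))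
  ∑-allFuns-suc xs n h = trans (∑-concatMap _ xs h)
    (∑-cong xs (λ a → reflexive (∑-map (a VF.∷_) (allFuns xs n) h)))

  ∑-distrib-+ : ∀ (xs : List A) f g → ∑ xs (λ x → f x + g x) ≈ ∑ xs f + ∑ xs g
  ∑-distrib-+ []       f g = sym (+-identityˡ 0#)
  ∑-distrib-+ (x ∷ xs) f g =
    trans (+-congˡ (∑-distrib-+ xs f g)) (interchange (f x) (g x) _ _)

  *-distribˡ-∑ : ∀ c (xs : List A) f → c * ∑ xs f ≈ ∑ xs (λ x → c * f x)
  *-distribˡ-∑ c []       f = zeroʳ c
  *-distribˡ-∑ c (x ∷ xs) f = trans (distribˡ c _ _) (+-congˡ (*-distribˡ-∑ c xs f))

  *-distribʳ-∑ : ∀ c (xs : List A) f → ∑ xs f * c ≈ ∑ xs (λ x → f x * c)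
  *-distribʳ-∑ c []       f = zeroˡ c
  *-distribʳ-∑ c (x ∷ xs) f = trans (distribʳ c _ _) (+-congˡ (*-distribʳ-∑ c xs f))

  ∑-allFuns-∏ : ∀ (xs : List A) (n : ℕ) (g : Fin n → A → Carrier) →
    ∑ (allFuns xs n) (λ f → ∏ (λ j → g j (f j))) ≈ ∏ (λ j → ∑ xs (g j))
  ∑-allFuns-∏ xs zero    g = +-identityʳ 1#
  ∑-allFuns-∏ xs (suc n) g = begin
    ∑ (allFuns xs (suc n)) (λ f → ∏ (λ j → g j (f j)))
      ≈⟨ ∑-allFuns-suc xs n _ ⟩
    ∑ xs (λ a → ∑ (allFuns xs n) (λ f → g zero a * ∏ (λ j → g (suc j) (f j))))
      ≈⟨ ∑-cong xs (λ a → *-distribˡ-∑ (g zero a) (allFuns xs n) _) ⟨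
    ∑ xs (λ a → g zero a * ∑ (allFuns xs n) (λ f → ∏ (λ j → g (suc j) (f j))))
      ≈⟨ ∑-cong xs (λ a → *-congˡ (∑-allFuns-∏ xs n (g ∘ suc))) ⟩
    ∑ xs (λ a → g zero a * ∏ (λ j → ∑ xs (g (suc j))))
      ≈⟨ *-distribʳ-∑ _ xs (g zero) ⟨
    ∑ xs (g zero) * ∏ (λ j → ∑ xs (g (suc j)))
      ∎

open import Algebra.Bundles using (CommutativeRing)
open import Data.Bool using (Bool; true; false; not; _∧_; _xor_; if_then_else_)
open import Data.Bool.ListAction using (all)
open import Data.Bool.Properties
  using (xor-∧-commutativeRing; ∧-distribˡ-xor; xor-comm; xor-identityʳ; true-xor)
open import Data.List using (allFin; length; tabulate)
open import Data.List.Properties using (length-map; length-tabulate)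
open import Data.Nat using (_+_; _*_; _^_; _∸_; _≤_; z≤n; s≤s)
open import Data.Nat.ListAction using (product)
open import Data.Nat.Properties
open import Data.Nat.Tactic.RingSolver using (solve-∀)
open import Algebra.Properties.CommutativeSemigroup *-commutativeSemigroup
  using (interchange; xy∙z≈xz∙y; x∙yz≈y∙xz; x∙yz≈yx∙z)
open import Data.Product using (Σ; _×_; _,_; proj₁; proj₂)
open import Data.Sum using (_⊎_; inj₁; inj₂)
open import Relation.Binary.PropositionalEquality

module F₂ = ListSum (CommutativeRing.commutativeSemiring xor-∧-commutativeRing)
open ListSum +-*-commutativeSemiring

∑-mono-≤ : ∀ {A : Set} (xs : List A) {f g : A → ℕ} →
  (∀ x → f x ≤ g x) → ∑ xs f ≤ ∑ xs g
∑-mono-≤ []       f≤g = z≤n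
∑-mono-≤ (x ∷ xs) f≤g = +-mono-≤ (f≤g x) (∑-mono-≤ xs f≤g)

^-distribʳ-* : ∀ a c t → (a * c) ^ t ≡ a ^ t * c ^ t
^-distribʳ-* a c zero    = refl
^-distribʳ-* a c (suc t) = trans (cong (a * c *_) (^-distribʳ-* a c t)) (interchange a c _ _)

∧-≡true : ∀ {a b} → a ∧ b ≡ true → a ≡ true × b ≡ true
∧-≡true {true} b≡true = refl , b≡true

𝟙 : Bool → ℕ
𝟙 b = if b then 1 else 0

∑𝟙≡0⊎witness : ∀ {A : Set} (p : A → Bool) xs →
  ∑ xs (𝟙 ∘ p) ≡ 0 ⊎ Σ A (λ a → p a ≡ true)
∑𝟙≡0⊎witness p []       = inj₁ refl
∑𝟙≡0⊎witness p (x ∷ xs) with p x in px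
... | true  = inj₂ (x , px)
... | false = ∑𝟙≡0⊎witness p xs

∑-allVecs-suc : ∀ k (h : F2^ (suc k) → ℕ) → ∑ (allVecs (suc k)) h ≡
  ∑ (allVecs k) (λ x → h (false VF.∷ x)) + ∑ (allVecs k) (λ x → h (true VF.∷ x))
∑-allVecs-suc k h = trans (∑-allFuns-suc allF2 k h)
  (cong (∑ (allVecs k) (λ x → h (false VF.∷ x)) +_) (+-identityʳ _))

∑-allVecs-1 : ∀ k → ∑ (allVecs k) (λ _ → 1) ≡ 2 ^ k
∑-allVecs-1 zero    = refl
∑-allVecs-1 (suc k) = begin
  ∑ (allVecs (suc k)) (λ _ → 1)
    ≡⟨ ∑-allVecs-suc k _ ⟩
  ∑ (allVecs k) (λ _ → 1) + ∑ (allVecs k) (λ _ → 1)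
    ≡⟨ cong₂ _+_ (∑-allVecs-1 k) (∑-allVecs-1 k) ⟩
  2 ^ k + 2 ^ k
    ≡⟨ cong (2 ^ k +_) (+-identityʳ (2 ^ k)) ⟨
  2 ^ suc k
    ∎
  where open ≡-Reasoning

_⊕_ : ∀ {k} → F2^ k → F2^ k → F2^ k
(x ⊕ a) i = x i xor a i

∑-translate : ∀ k (h : F2^ k → ℕ) → (∀ {x y} → x ≗ y → h x ≡ h y) → ∀ a →
  ∑ (allVecs k) h ≡ ∑ (allVecs k) (λ x → h (x ⊕ a))
∑-translate zero    h h-ext a = cong (_+ 0) (h-ext (λ ()))
∑-translate (suc k) h h-ext a = begin
  ∑ (allVecs (suc k)) h
    ≡⟨ ∑-allVecs-suc k h ⟩
  S false + S true
    ≡⟨ swap (a zero) ⟩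
  S (false xor a zero) + S (true xor a zero)
    ≡⟨ cong₂ _+_ (shift false) (shift true) ⟨
  ∑ (allVecs k) (λ x → h ((false VF.∷ x) ⊕ a))
    + ∑ (allVecs k) (λ x → h ((true VF.∷ x) ⊕ a))
    ≡⟨ ∑-allVecs-suc k (λ x → h (x ⊕ a)) ⟨
  ∑ (allVecs (suc k)) (λ x → h (x ⊕ a))
    ∎
  where
  open ≡-Reasoning
  S : Bool → ℕ
  S c = ∑ (allVecs k) (λ x → h (c VF.∷ x))
  swap : ∀ b → S false + S true ≡ S (false xor b) + S (true xor b)
  swap false = refl
  swap true  = +-comm (S false) (S true)
  shift : ∀ c → ∑ (allVecs k) (λ x → h ((c VF.∷ x) ⊕ a)) ≡ S (c xor a zero)
  shift c = trans
    (∑-cong (allVecs k) (λ x → h-ext λ { zero → refl ; (suc i) → refl }))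
    (sym (∑-translate k (λ x → h ((c xor a zero) VF.∷ x))
      (λ x≗y → h-ext λ { zero → refl ; (suc i) → x≗y i }) (VF.tail a)))

infix 7 _·_

_·_ : ∀ {k} → F2^ k → F2^ k → F2
_·_ {k} u x = sumF2 (map (λ i → u i ∧ x i) (allFin k))

·-congʳ : ∀ {k} (u : F2^ k) {x y} → x ≗ y → u · x ≡ u · y
·-congʳ {k} u x≗y = F₂.∑-cong (allFin k) (λ i → cong (u i ∧_) (x≗y i))

·-distribˡ-⊕ : ∀ {k} (u x a : F2^ k) → u · (x ⊕ a) ≡ u · x xor u · a
·-distribˡ-⊕ {k} u x a = trans
  (F₂.∑-cong (allFin k) (λ i → ∧-distribˡ-xor (u i) (x i) (a i)))
  (F₂.∑-distrib-+ (allFin k) (λ i → u i ∧ x i) (λ i → u i ∧ a i))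

·-⊕ : ∀ {k} (u x : F2^ k) {a c} → u · a ≡ c → u · (x ⊕ a) ≡ u · x xor c
·-⊕ u x {a} u·a≡c = trans (·-distribˡ-⊕ u x a) (cong (u · x xor_) u·a≡c)

annihilates : ∀ {k} → List (F2^ k) → F2^ k → Bool
annihilates Z x = all (λ v → not (v · x)) Z

annihilates-cong : ∀ {k} (Z : List (F2^ k)) {x y} →
  x ≗ y → annihilates Z x ≡ annihilates Z y
annihilates-cong []      x≗y = refl
annihilates-cong (v ∷ Z) x≗y =
  cong₂ _∧_ (cong not (·-congʳ v x≗y)) (annihilates-cong Z x≗y)

annihilates-⊕ : ∀ {k} (Z : List (F2^ k)) x {a} → annihilates Z a ≡ true →
  annihilates Z (x ⊕ a) ≡ annihilates Z x
annihilates-⊕ []      x       Za = refl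
annihilates-⊕ (v ∷ Z) x {a}   Za with v · a in v·a
annihilates-⊕ (v ∷ Z) x {a}   () | true
annihilates-⊕ (v ∷ Z) x {a}   Za | false = cong₂ _∧_
  (cong not (trans (·-⊕ v x v·a) (xor-identityʳ (v · x))))
  (annihilates-⊕ Z x Za)

annihilator-halves : ∀ k (v : F2^ k) (Z : List (F2^ k)) →
  ∑ (allVecs k) (𝟙 ∘ annihilates Z) ≤ 2 * ∑ (allVecs k) (𝟙 ∘ annihilates (v ∷ Z))
annihilator-halves k v Z = begin
  ∑ V (𝟙 ∘ annihilates Z)
    ≡⟨ ∑-cong V (λ x → 𝟙-split (v · x) (annihilates Z x)) ⟩
  ∑ V (λ x → 𝟙 (not (v · x) ∧ annihilates Z x) + 𝟙 (v · x ∧ annihilates Z x))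
    ≡⟨ ∑-distrib-+ V _ _ ⟩
  E + O  ≤⟨ +-monoʳ-≤ E O≤E ⟩
  E + E  ≡⟨ cong (E +_) (+-identityʳ E) ⟨
  2 * E  ∎
  where
  open ≤-Reasoning
  V = allVecs k
  E = ∑ V (𝟙 ∘ annihilates (v ∷ Z))
  O = ∑ V (λ x → 𝟙 (v · x ∧ annihilates Z x))
  𝟙-split : ∀ p z → 𝟙 z ≡ 𝟙 (not p ∧ z) + 𝟙 (p ∧ z)
  𝟙-split true  z     = refl
  𝟙-split false true  = refl
  𝟙-split false false = refl
  O≤E : O ≤ E
  O≤E with ∑𝟙≡0⊎witness (λ x → v · x ∧ annihilates Z x) V
  ... | inj₁ O≡0 = ≤-trans (≤-reflexive O≡0) z≤n
  ... | inj₂ (a , v·a∧Za) =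
    ≤-reflexive (trans (∑-translate k _ ext a)
      (∑-cong V (λ x → cong 𝟙 (cong₂ _∧_ (flip x) (Za⊕ x)))))
    where
    ext : ∀ {x y} → x ≗ y → 𝟙 (v · x ∧ annihilates Z x) ≡ 𝟙 (v · y ∧ annihilates Z y)
    ext x≗y = cong 𝟙 (cong₂ _∧_ (·-congʳ v x≗y) (annihilates-cong Z x≗y))
    flip : ∀ x → v · (x ⊕ a) ≡ not (v · x)
    flip x = trans (·-⊕ v x (proj₁ (∧-≡true v·a∧Za))) (trans (xor-comm _ true) (true-xor _))
    Za⊕ : ∀ x → annihilates Z (x ⊕ a) ≡ annihilates Z x
    Za⊕ x = annihilates-⊕ Z x (proj₂ (∧-≡true v·a∧Za))

annihilator-size : ∀ k (Z : List (F2^ k)) →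
  2 ^ k ≤ 2 ^ length Z * ∑ (allVecs k) (𝟙 ∘ annihilates Z)
annihilator-size k []      = ≤-reflexive (trans (sym (∑-allVecs-1 k)) (sym (+-identityʳ _)))
annihilator-size k (v ∷ Z) = begin
  2 ^ k
    ≤⟨ annihilator-size k Z ⟩
  2 ^ length Z * ∑ V (𝟙 ∘ annihilates Z)
    ≤⟨ *-monoʳ-≤ (2 ^ length Z) (annihilator-halves k v Z) ⟩
  2 ^ length Z * (2 * ∑ V (𝟙 ∘ annihilates (v ∷ Z)))
    ≡⟨ x∙yz≈yx∙z (2 ^ length Z) 2 _ ⟩
  2 ^ length (v ∷ Z) * ∑ V (𝟙 ∘ annihilates (v ∷ Z))
    ∎
  where
  open ≤-Reasoning
  V = allVecs k

weight : ∀ {k} → ℕ → List (F2^ k) → F2^ k → ℕ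
weight b W x = product (map (λ w → if w · x then b else suc b) W)

𝟙-*-weightFactor : ∀ b p z X →
  𝟙 z * ((if p then b else suc b) * X) ≡ b * (𝟙 z * X) + 𝟙 (not p ∧ z) * X
𝟙-*-weightFactor b true  z X = trans (x∙yz≈y∙xz (𝟙 z) b X) (sym (+-identityʳ _))
𝟙-*-weightFactor b false z X = expand b (𝟙 z) X
  where
  expand : ∀ b z X → z * (suc b * X) ≡ b * (z * X) + z * X
  expand = solve-∀

-- Z holds the w ∈ W whose summand [w · x = 0] was chosen so far in expanding
-- ∏_{w ∈ W} (b + [w · x = 0]).
weighted-annihilator-size : ∀ k b (W Z : List (F2^ k)) →
  2 ^ k * (b + suc b) ^ length W ≤
    2 ^ length Z * 2 ^ length W * ∑ (allVecs k) (λ x → 𝟙 (annihilates Z x) * weight b W x)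
weighted-annihilator-size k b [] Z = begin
  2 ^ k * 1
    ≡⟨ *-identityʳ (2 ^ k) ⟩
  2 ^ k
    ≤⟨ annihilator-size k Z ⟩
  2 ^ length Z * ∑ V (𝟙 ∘ annihilates Z)
    ≡⟨ cong₂ _*_ (*-identityʳ (2 ^ length Z)) (∑-cong V (*-identityʳ ∘ 𝟙 ∘ annihilates Z)) ⟨
  2 ^ length Z * 1 * ∑ V (λ x → 𝟙 (annihilates Z x) * 1)
    ∎
  where
  open ≤-Reasoning
  V = allVecs k
weighted-annihilator-size k b (w ∷ W) Z = begin
  2 ^ k * (b + suc b) ^ suc t
    ≡⟨ expand (2 ^ k) ((b + suc b) ^ t) b ⟩
  2 * b * (2 ^ k * (b + suc b) ^ t) + 2 ^ k * (b + suc b) ^ t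
    ≤⟨ +-mono-≤ (*-monoʳ-≤ (2 * b) (weighted-annihilator-size k b W Z))
                (weighted-annihilator-size k b W (w ∷ Z)) ⟩
  2 * b * (2 ^ z * 2 ^ t * F Z) + 2 * 2 ^ z * 2 ^ t * F (w ∷ Z)
    ≡⟨ collect (2 ^ z) (2 ^ t) b (F Z) (F (w ∷ Z)) ⟩
  2 ^ z * 2 ^ suc t * (b * F Z + F (w ∷ Z))
    ≡⟨ cong (2 ^ z * 2 ^ suc t *_) split ⟨
  2 ^ z * 2 ^ suc t * ∑ V (λ x → 𝟙 (annihilates Z x) * weight b (w ∷ W) x)
    ∎
  where
  open ≤-Reasoning
  V = allVecs k
  t = length W
  z = length Z
  F : List (F2^ k) → ℕ
  F Z′ = ∑ V (λ x → 𝟙 (annihilates Z′ x) * weight b W x)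
  split : ∑ V (λ x → 𝟙 (annihilates Z x) * weight b (w ∷ W) x) ≡ b * F Z + F (w ∷ Z)
  split = begin-equality
    ∑ V (λ x → 𝟙 (annihilates Z x) * weight b (w ∷ W) x)
      ≡⟨ ∑-cong V (λ x → 𝟙-*-weightFactor b (w · x) (annihilates Z x) (weight b W x)) ⟩
    ∑ V (λ x → b * (𝟙 (annihilates Z x) * weight b W x)
               + 𝟙 (annihilates (w ∷ Z) x) * weight b W x)
      ≡⟨ ∑-distrib-+ V _ _ ⟩
    ∑ V (λ x → b * (𝟙 (annihilates Z x) * weight b W x)) + F (w ∷ Z)
      ≡⟨ cong (_+ F (w ∷ Z)) (*-distribˡ-∑ b V _) ⟨
    b * F Z + F (w ∷ Z)
      ∎
  expand : ∀ m P b → m * ((b + suc b) * P) ≡ 2 * b * (m * P) + m * P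
  expand = solve-∀
  collect : ∀ z q b G₁ G₂ →
    2 * b * (z * q * G₁) + 2 * z * q * G₂ ≡ z * (2 * q) * (b * G₁ + G₂)
  collect = solve-∀

weight-average : ∀ k b (W : List (F2^ k)) →
  2 ^ k * (b + suc b) ^ length W ≤ 2 ^ length W * ∑ (allVecs k) (weight b W)
weight-average k b W = begin
  2 ^ k * (b + suc b) ^ length W
    ≤⟨ weighted-annihilator-size k b W [] ⟩
  1 * 2 ^ length W * ∑ V (λ x → 1 * weight b W x)
    ≡⟨ cong₂ _*_ (*-identityˡ (2 ^ length W)) (∑-cong V (*-identityˡ ∘ weight b W)) ⟩
  2 ^ length W * ∑ V (weight b W)
    ∎
  where
  open ≤-Reasoning
  V = allVecs k

rankOneForm : ∀ {k d} → (Fin d → F2^ k) → (Fin d → F2^ k) → F2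
rankOneForm u x = prodF2 (λ j → u j · x j)

multilinear-outer : ∀ {k d} (T : Tensor k d) (u : Fin d → F2^ k) →
  (∀ idx → T idx ≡ prodF2 (λ j → u j (idx j))) →
  ∀ x → multilinear T x ≡ rankOneForm u x
multilinear-outer {k} {d} T u T≡u x = trans
  (F₂.∑-cong (allIdx k d) (λ idx → trans (cong (_∧ _) (T≡u idx))
    (sym (F₂.∏-distrib-* (λ j → u j (idx j)) (λ j → x j (idx j))))))
  (F₂.∑-allFuns-∏ (allFin k) d (λ j i → u j i ∧ x j i))

-- The zero tensor is the outer product of zero vectors only when d ≥ 1.
outerFactors : ∀ {k d} {T : Tensor k d} → 1 ≤ d → RankAtMostOne T →
  Σ (Fin d → F2^ k) (λ u → ∀ idx → T idx ≡ prodF2 (λ j → u j (idx j)))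
outerFactors (s≤s z≤n) (inj₁ T≡0)   = (λ _ _ → false) , T≡0
outerFactors _         (inj₂ u,T≡u) = u,T≡u

vanishes : ∀ {k d} → List (Fin d → F2^ k) → (Fin d → F2^ k) → Bool
vanishes L x = all (λ u → not (rankOneForm u x)) L

zeroCount : ∀ k d → List (Fin d → F2^ k) → ℕ
zeroCount k d L = ∑ (allFuns (allVecs k) d) (𝟙 ∘ vanishes L)

-- Forms with ⟨u₁, x₀⟩ = 0 vanish identically once x₁ = x₀, so they are dropped.
fixFirst : ∀ {k d} → F2^ k → List (Fin (suc d) → F2^ k) → List (Fin d → F2^ k)
fixFirst x₀ []      = []
fixFirst x₀ (u ∷ L) =
  if VF.head u · x₀ then VF.tail u ∷ fixFirst x₀ L else fixFirst x₀ L

vanishes-fixFirst : ∀ {k d} x₀ (x : Fin d → F2^ k) L →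
  vanishes L (x₀ VF.∷ x) ≡ vanishes (fixFirst x₀ L) x
vanishes-fixFirst x₀ x []      = refl
vanishes-fixFirst x₀ x (u ∷ L) with VF.head u · x₀
... | true  = cong (_ ∧_) (vanishes-fixFirst x₀ x L)
... | false = vanishes-fixFirst x₀ x L

zeroCount-suc : ∀ k d L →
  zeroCount k (suc d) L ≡ ∑ (allVecs k) (λ x₀ → zeroCount k d (fixFirst x₀ L))
zeroCount-suc k d L = trans (∑-allFuns-suc (allVecs k) d _) (∑-cong (allVecs k) (λ x₀ →
  ∑-cong (allFuns (allVecs k) d) (λ x → cong 𝟙 (vanishes-fixFirst x₀ x L))))

weight-fixFirst : ∀ {k d} b x₀ (L : List (Fin (suc d) → F2^ k)) →
  weight b (map VF.head L) x₀ * suc b ^ length (fixFirst x₀ L) ≡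
    b ^ length (fixFirst x₀ L) * suc b ^ length L
weight-fixFirst b x₀ []      = refl
weight-fixFirst b x₀ (u ∷ L) with VF.head u · x₀
... | true  = trans (interchange b w (suc b) (suc b ^ r))
  (trans (cong (b * suc b *_) (weight-fixFirst b x₀ L)) (interchange b (suc b) (b ^ r) _))
  where
  w = weight b (map VF.head L) x₀
  r = length (fixFirst x₀ L)
... | false = trans (*-assoc (suc b) w (suc b ^ r))
  (trans (cong (suc b *_) (weight-fixFirst b x₀ L)) (x∙yz≈y∙xz (suc b) (b ^ r) _))
  where
  w = weight b (map VF.head L) x₀
  r = length (fixFirst x₀ L)

zeroCount-fixFirst : ∀ k d b →
  (∀ L → b ^ length L * 2 ^ (k * d) ≤ zeroCount k d L * suc b ^ length L) →
  ∀ x₀ (L : List (Fin (suc d) → F2^ k)) →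
  weight b (map VF.head L) x₀ * 2 ^ (k * d) ≤ zeroCount k d (fixFirst x₀ L) * suc b ^ length L
zeroCount-fixFirst k d b IH x₀ L = *-cancelʳ-≤ _ _ (suc b ^ r) {{m^n≢0 (suc b) r}} (begin
  w * m * suc b ^ r          ≡⟨ xy∙z≈xz∙y w m _ ⟩
  w * suc b ^ r * m          ≡⟨ cong (_* m) (weight-fixFirst b x₀ L) ⟩
  b ^ r * suc b ^ t * m      ≡⟨ xy∙z≈xz∙y (b ^ r) _ m ⟩
  b ^ r * m * suc b ^ t      ≤⟨ *-monoˡ-≤ (suc b ^ t) (IH (fixFirst x₀ L)) ⟩
  C * suc b ^ r * suc b ^ t  ≡⟨ xy∙z≈xz∙y C _ _ ⟩
  C * suc b ^ t * suc b ^ r  ∎)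
  where
  open ≤-Reasoning
  w = weight b (map VF.head L) x₀
  m = 2 ^ (k * d)
  r = length (fixFirst x₀ L)
  t = length L
  C = zeroCount k d (fixFirst x₀ L)

zeroCount-bound-suc : ∀ k d n → 1 ≤ n →
  (∀ L → (n ∸ 1) ^ length L * 2 ^ (k * d) ≤ zeroCount k d L * n ^ length L) →
  ∀ L → (2 * n ∸ 1) ^ length L * 2 ^ (k * suc d) ≤
        zeroCount k (suc d) L * (2 * n) ^ length L
zeroCount-bound-suc k d (suc b) _ IH L = begin
  (2 * suc b ∸ 1) ^ t * 2 ^ (k * suc d)
    ≡⟨ cong₂ (λ B e → B ^ t * 2 ^ e) (cong (b +_) (+-identityʳ (suc b))) (*-suc k d) ⟩
  (b + suc b) ^ t * 2 ^ (k + k * d)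
    ≡⟨ cong ((b + suc b) ^ t *_) (^-distribˡ-+-* 2 k (k * d)) ⟩
  (b + suc b) ^ t * (2 ^ k * m)
    ≡⟨ x∙yz≈yx∙z ((b + suc b) ^ t) (2 ^ k) m ⟩
  2 ^ k * (b + suc b) ^ t * m
    ≤⟨ *-monoˡ-≤ m averaged ⟩
  2 ^ t * ∑ V (weight b W) * m
    ≡⟨ trans (*-assoc (2 ^ t) _ m) (cong (2 ^ t *_) (*-distribʳ-∑ m V (weight b W))) ⟩
  2 ^ t * ∑ V (λ x₀ → weight b W x₀ * m)
    ≤⟨ *-monoʳ-≤ (2 ^ t) (∑-mono-≤ V (λ x₀ → zeroCount-fixFirst k d b IH x₀ L)) ⟩
  2 ^ t * ∑ V (λ x₀ → C x₀ * suc b ^ t)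
    ≡⟨ cong (2 ^ t *_) (*-distribʳ-∑ (suc b ^ t) V C) ⟨
  2 ^ t * (∑ V C * suc b ^ t)
    ≡⟨ x∙yz≈y∙xz (2 ^ t) (∑ V C) (suc b ^ t) ⟩
  ∑ V C * (2 ^ t * suc b ^ t)
    ≡⟨ cong₂ _*_ (zeroCount-suc k d L) (^-distribʳ-* 2 (suc b) t) ⟨
  zeroCount k (suc d) L * (2 * suc b) ^ t
    ∎
  where
  open ≤-Reasoning
  t = length L
  m = 2 ^ (k * d)
  V = allVecs k
  W = map VF.head L
  C : F2^ k → ℕ
  C x₀ = zeroCount k d (fixFirst x₀ L)
  averaged : 2 ^ k * (b + suc b) ^ t ≤ 2 ^ t * ∑ V (weight b W)
  averaged = subst (λ s → 2 ^ k * (b + suc b) ^ s ≤ 2 ^ s * ∑ V (weight b W))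
    (length-map VF.head L) (weight-average k b W)

zeroCount-bound : ∀ k d (L : List (Fin d → F2^ k)) →
  (2 ^ d ∸ 1) ^ length L * 2 ^ (k * d) ≤ zeroCount k d L * (2 ^ d) ^ length L
zeroCount-bound k zero    []      rewrite *-zeroʳ k = ≤-refl
zeroCount-bound k zero    (_ ∷ _) = z≤n
zeroCount-bound k (suc d) L       =
  zeroCount-bound-suc k d (2 ^ d) (m^n>0 2 d) (zeroCount-bound k d) L

allVanish-tabulate : ∀ {k d t} (M : Fin t → Tensor k d) (U : Fin t → Fin d → F2^ k) →
  (∀ i x → multilinear (M i) x ≡ rankOneForm (U i) x) →
  ∀ x → allVanish M x ≡ vanishes (tabulate U) x
allVanish-tabulate {t = zero}  M U M≡U x = refl
allVanish-tabulate {t = suc t} M U M≡U x = cong₂ _∧_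
  (trans (cong (λ b → if b then false else true) (M≡U zero x)) (if-then-false-else-true _))
  (allVanish-tabulate (M ∘ suc) (U ∘ suc) (M≡U ∘ suc) x)
  where
  if-then-false-else-true : ∀ b → (if b then false else true) ≡ not b
  if-then-false-else-true true  = refl
  if-then-false-else-true false = refl

lemma4p2 : (k d t : ℕ) → 1 ≤ d → (M : Fin t → Tensor k d) →
    (∀ i → RankAtMostOne (M i)) →
    (2 ^ d ∸ 1) ^ t * 2 ^ (k * d) ≤ countVanish M * (2 ^ d) ^ t
lemma4p2 k d t d≥1 M rankOne = begin
  (2 ^ d ∸ 1) ^ t * 2 ^ (k * d)
    ≡⟨ cong (λ s → (2 ^ d ∸ 1) ^ s * 2 ^ (k * d)) |L|≡t ⟨
  (2 ^ d ∸ 1) ^ length L * 2 ^ (k * d)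
    ≤⟨ zeroCount-bound k d L ⟩
  zeroCount k d L * (2 ^ d) ^ length L
    ≡⟨ cong₂ (λ c s → c * (2 ^ d) ^ s) zeroCount≡ |L|≡t ⟩
  countVanish M * (2 ^ d) ^ t
    ∎
  where
  open ≤-Reasoning
  factors : ∀ i → Σ (Fin d → F2^ k) (λ u → ∀ idx → M i idx ≡ prodF2 (λ j → u j (idx j)))
  factors i = outerFactors d≥1 (rankOne i)
  L = tabulate (proj₁ ∘ factors)
  |L|≡t : length L ≡ t
  |L|≡t = length-tabulate _
  zeroCount≡ : zeroCount k d L ≡ countVanish M
  zeroCount≡ = ∑-cong (allFuns (allVecs k) d) (λ x → cong 𝟙 (sym
    (allVanish-tabulate M _ (λ i → multilinear-outer (M i) _ (proj₂ (factors i))) x)))
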